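{- For each odd integer $\ell \geqslant 3$, we have $\delta^*_{C_{\ell}} \geqslant \frac{1}{2}+\frac{1}{2\ell-2}$.
   Context: $C_\ell$ is the cycle of length $\ell$. For a graph $H$, $\gcd(H)$ is the largest integer dividing all vertex degrees of $H$; a graph $G$ is $C_\ell$-divisible if $\ell$ divides $|E(G)|$ and $\gcd(C_\ell)=2$ divides $\gcd(G)$. A fractional $C_\ell$-decomposition of a graph $G$ is a finite collection of pairs $(C,\alpha)$ where $C$ is a subgraph of $G$ isomorphic to $C_\ell$ and $\alpha>0$, such that for each edge $e$ of $G$ the sum of $\alpha$ over pairs with $e\in E(C)$ is exactly $1$. The fractional decomposition threshold $\delta^*_{C_\ell}$ is the infimum of all reals $\delta\geqslant 0$ such that for every sufficiently large $n$, every $C_\ell$-divisible $n$-vertex graph with minimum degree at least $\delta n$ has a fractional $C_\ell$-decomposition.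
   Formalization: The values δ in the infimum defining $\delta^*_{C_\ell}$ range over the nonnegative rationals rather than the nonnegative reals, and the weights α of fractional $C_\ell$-decompositions are rational. -}

module Defs where

open import Data.Bool using (Bool; true; false; _∧_; _∨_; if_then_else_; T)
open import Data.Nat as ℕ using (ℕ; zero; suc; _∸_; _≤_; _<_; s≤s; _<?_)
open import Data.Nat.Divisibility using (_∣_)
open import Data.Nat.GCD using (gcd)
open import Data.Fin using (Fin; zero; suc; toℕ; fromℕ<; _≟_)
open import Data.List using (List; []; _∷_; foldr; map; length; filter)
open import Data.List.Base using (allFin)
open import Data.List.Relation.Unary.All using (All)
open import Data.Product using (proj₁; proj₂; Σ; _×_; _,_; ∃; ∃-syntax)
open import Data.Integer using (+_)
open import Data.Rational using (ℚ; 0ℚ; 1ℚ; ½) renaming (_+_ to _+ℚ_; _*_ to _*ℚ_; _≤_ to _≤ℚ_; _<_ to _<ℚ_; _/_ to _/ℚ_)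
open import Function.Definitions using (Injective)
open import Relation.Binary.PropositionalEquality using (_≡_)
open import Relation.Nullary using (¬_; Dec; yes; no)
open import Relation.Nullary.Decidable using (⌊_⌋)

record Graph (n : ℕ) : Set where
  field
    adj   : Fin n → Fin n → Bool
    sym   : ∀ u v → adj u v ≡ adj v u
    irrefl : ∀ v → adj v v ≡ false
open Graph public

Adj : ∀ {n} → Graph n → Fin n → Fin n → Set
Adj G u v = T (adj G u v)

count : ∀ {n} → (Fin n → Bool) → ℕ
count {n} p = length (filter (λ i → T? (p i)) (allFin n))
  where
    T? : (b : Bool) → Dec (T b)
    T? true  = yes _
    T? false = no (λ ())

deg : ∀ {n} → Graph n → Fin n → ℕ
deg G v = count (λ u → adj G v u)

numEdges : ∀ {n} → Graph n → ℕ
numEdges {n} G =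
  foldr ℕ._+_ 0 (map (λ u → count (λ v → adj G u v ∧ ⌊ toℕ u <? toℕ v ⌋)) (allFin n))

-- gcd(G): gcd of all vertex degrees (0 if there are no vertices / all degrees 0)
gcdG : ∀ {n} → Graph n → ℕ
gcdG {n} G = foldr gcd 0 (map (deg G) (allFin n))

-- gcd(C_ℓ) = 2 (every vertex of a cycle has degree 2)
gcdCycle : ℕ
gcdCycle = 2

CycleDivisible : ∀ {n} → ℕ → Graph n → Set
CycleDivisible ℓ G = (ℓ ∣ numEdges G) × (gcdCycle ∣ gcdG G)

next : ∀ {ℓ} → Fin ℓ → Fin ℓ
next {suc k} i with toℕ i <? k
... | yes p = fromℕ< (s≤s p)
... | no _  = zero

-- A copy of C_ℓ in G: an injective cyclic sequence of ℓ vertices with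
-- consecutive vertices (indices mod ℓ) adjacent in G.  The subgraph is the
-- set of edges {f i, f (i+1 mod ℓ)}.
record CycleIn {n : ℕ} (ℓ : ℕ) (G : Graph n) : Set where
  field
    vert  : Fin ℓ → Fin n
    inj   : Injective _≡_ _≡_ vert
    edges : ∀ i → Adj G (vert i) (vert (next i))
open CycleIn public

edgeInCycle : ∀ {n ℓ} {G : Graph n} → CycleIn ℓ G → Fin n → Fin n → Bool
edgeInCycle {ℓ = ℓ} C u v =
  foldr _∨_ false
    (map (λ i → (⌊ vert C i ≟ u ⌋ ∧ ⌊ vert C (next i) ≟ v ⌋)
              ∨ (⌊ vert C i ≟ v ⌋ ∧ ⌊ vert C (next i) ≟ u ⌋))
         (allFin ℓ))

-- A fractional C_ℓ-decomposition of G: a finite collection of pairs (C, α)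
-- with α > 0 such that for every edge e of G, the sum of α over the
-- pairs whose cycle contains e is exactly 1.  (Weights are rational.)
weightOn : ∀ {n ℓ} {G : Graph n} → List (CycleIn ℓ G × ℚ) → Fin n → Fin n → ℚ
weightOn ps u v =
  foldr _+ℚ_ 0ℚ (map (λ p → if edgeInCycle (proj₁ p) u v then proj₂ p else 0ℚ) ps)

record FracDecomp {n : ℕ} (ℓ : ℕ) (G : Graph n) : Set where
  field
    pieces   : List (CycleIn ℓ G × ℚ)
    positive : All (λ p → 0ℚ <ℚ proj₂ p) pieces
    exact    : ∀ u v → Adj G u v → weightOn pieces u v ≡ 1ℚ

-- δ (≥ 0) lies in the set whose infimum defines δ*_{C_ℓ}: for every
-- sufficiently large n, every C_ℓ-divisible n-vertex graph with minimum
-- degree ≥ δ n has a fractional C_ℓ-decomposition.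
ThresholdHolds : ℕ → ℚ → Set
ThresholdHolds ℓ δ =
  ∃[ N ] ∀ n → N ≤ n → (G : Graph n) → CycleDivisible ℓ G →
    (∀ v → δ *ℚ ((+ n) /ℚ 1) ≤ℚ ((+ deg G v) /ℚ 1)) → FracDecomp ℓ G

-- 1/d as a rational (with 1/0 := 0, never used below since 2ℓ-2 > 0 for ℓ ≥ 3)
recip : ℕ → ℚ
recip zero    = 0ℚ
recip (suc d) = (+ 1) /ℚ suc d

lowerBound : ℕ → ℚ
lowerBound ℓ = ½ +ℚ recip (2 ℕ.* ℓ ∸ 2)

Odd : ℕ → Set
Odd ℓ = ¬ (2 ∣ ℓ)

module Submission where

-- Write ℓ = 2t + 1 and k = 2t. Take 2k cliques of c + 1 vertices (the classes) and join every vertex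
-- of the first k classes to every vertex of the last k. The graph is ((c + 1)k + c)-regular on
-- 2k(c + 1) vertices, so its degree ratio tends to 1/2 + 1/(2ℓ - 2), and c can be chosen to make it
-- C_ℓ-divisible and as large and dense as required. Colour each vertex by the half its class lies in.
-- An odd cycle cannot alternate colours, so it has a monochromatic edge and at most 2t = k
-- bichromatic ones. In a fractional C_ℓ-decomposition every edge has total weight 1, so summing over
-- the cycles, the graph has at most k times as many bichromatic as monochromatic edges. But every
-- vertex has (c + 1)k bichromatic and only c monochromatic neighbours.

open import Algebra.Bundles using (Ring)
import Algebra.Properties.Semiring.Sum as Sum
open import Data.Bool using (Bool; true; false; not; _∧_; _∨_; _xor_; if_then_else_; T)
open import Data.Bool.ListAction using (any)
open import Data.Bool.Properties using (xor-comm; xor-same; ∧-comm; ∧-identityʳ; ∧-zeroʳ; ∨-zeroʳ; not-¬; ¬-not; not-involutive) renaming (_≟_ to _≟ᵇ_)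
open import Data.Fin using (Fin; zero; suc; toℕ; _≟_)
open import Data.Fin.Properties using (toℕ-injective; toℕ<n; toℕ-fromℕ<; ¬∀⟶∃¬)
import Data.Integer as ℤ
import Data.Integer.Properties as ℤ
open import Data.List using (List; []; _∷_; foldr; map; length; filter; tabulate)
open import Data.List.Relation.Unary.All using (All; []; _∷_)
open import Data.List.Relation.Unary.All.Properties using (map⁺; tabulate⁺)
open import Data.Nat using (ℕ; zero; suc; _+_; _*_; _∸_; _≤_; _<_; z≤n; s≤s; _<?_; NonZero; >-nonZero; >-nonZero⁻¹)
open import Data.Nat.Coprimality using (Coprime; 1-coprimeTo) renaming (sym to Coprime-sym)
open import Data.Nat.DivMod using (_%_; _mod_; [m+n]%n≡m%n; m<n⇒m%n≡m)
open import Data.Nat.Divisibility using (_∣_; divides; _∣0; ∣-refl; ∣m∣n⇒∣m+n; ∣m⇒∣m*n; ∣n⇒∣m*n; m∣m*n)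
open import Data.Nat.GCD using (gcd; gcd-greatest)
open import Data.Nat.Properties hiding (_≟_)
open import Data.Nat.Tactic.RingSolver using (solve-∀)
open import Data.Product using (∃-syntax; _,_; _×_; proj₁; proj₂)
open import Data.Rational using (ℚ; mkℚ; 0ℚ; ½; _/_; *≤*; nonNegative; toℚᵘ) renaming (_+_ to _+ℚ_; _*_ to _*ℚ_; _≤_ to _≤ℚ_; _<_ to _<ℚ_)
import Data.Rational.Properties as ℚ
open import Data.Rational.Unnormalised using (mkℚᵘ) renaming (_≃_ to _≃ᵘ_; _+_ to _+ᵘ_)
import Data.Rational.Unnormalised as ℚᵘ
import Data.Rational.Unnormalised.Properties as ℚᵘ
open import Data.Empty using (⊥-elim)
open import Data.Unit using (tt)
open import Function using (_∘_; id)
open import Relation.Binary.PropositionalEquality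
open import Relation.Nullary using (Dec; yes; no; ¬_; contradiction)
open import Relation.Nullary.Decidable using (⌊_⌋; ⌊⌋-map′; isYes≗does; dec-true; dec-false)

open import Defs hiding (sym)

open Sum +-*-semiring
module ℚΣ = Sum (Ring.semiring ℚ.+-*-ring)

𝟙 : Bool → ℕ
𝟙 b = if b then 1 else 0

𝟙≤1 : ∀ b → 𝟙 b ≤ 1
𝟙≤1 true  = ≤-refl
𝟙≤1 false = z≤n

𝟙-∨-disjoint : ∀ p q → (q ≡ true → p ≡ false) → 𝟙 (p ∨ q) ≡ 𝟙 p + 𝟙 q
𝟙-∨-disjoint p     true  q⇒¬p rewrite q⇒¬p refl = refl
𝟙-∨-disjoint true  false _    = refl
𝟙-∨-disjoint false false _    = refl

𝟙-split : ∀ p q → 𝟙 p ≡ (if q then 𝟙 p else 0) + 𝟙 (p ∧ not q)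
𝟙-split p true  = sym (trans (cong (𝟙 p +_) (cong 𝟙 (∧-zeroʳ p))) (+-identityʳ _))
𝟙-split p false = sym (cong 𝟙 (∧-identityʳ p))

⌊≟⌋-refl : ∀ {n} (a : Fin n) → ⌊ a ≟ a ⌋ ≡ true
⌊≟⌋-refl a = trans (isYes≗does (a ≟ a)) (dec-true (a ≟ a) refl)

⌊≟⌋-sym : ∀ {m} (a b : Fin m) → ⌊ a ≟ b ⌋ ≡ ⌊ b ≟ a ⌋
⌊≟⌋-sym a b with a ≟ b | b ≟ a
... | yes _   | yes _   = refl
... | no _    | no _    = refl
... | yes a≡b | no b≢a  = contradiction (sym a≡b) b≢a
... | no a≢b  | yes b≡a = contradiction (sym b≡a) a≢b

-- Finite sums

∑-mono-≤ : ∀ {n} {f g : Fin n → ℕ} → (∀ i → f i ≤ g i) → sum f ≤ sum g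
∑-mono-≤ {zero}  _   = z≤n
∑-mono-≤ {suc n} f≤g = +-mono-≤ (f≤g zero) (∑-mono-≤ (f≤g ∘ suc))

∑-const : ∀ n c → ∑[ i < n ] c ≡ n * c
∑-const zero    c = refl
∑-const (suc n) c = cong (c +_) (∑-const n c)

∑-if : ∀ {n} b (f : Fin n → ℕ) → ∑[ i < n ] (if b then f i else 0) ≡ (if b then sum f else 0)
∑-if true  f = refl
∑-if {n} false f = sum-replicate-zero n

∑-delta : ∀ {n} (a : Fin n) (f : Fin n → ℕ) → ∑[ i < n ] (if ⌊ a ≟ i ⌋ then f i else 0) ≡ f a
∑-delta {suc n} zero    f = trans (cong (f zero +_) (sum-replicate-zero n)) (+-identityʳ _)
∑-delta {suc n} (suc a) f = begin
  ∑[ i < n ] (if ⌊ suc a ≟ suc i ⌋ then f (suc i) else 0)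
    ≡⟨ sum-cong-≗ {n} (λ i → cong (if_then f (suc i) else 0) (⌊⌋-map′ _ _ (a ≟ i))) ⟩
  ∑[ i < n ] (if ⌊ a ≟ i ⌋ then f (suc i) else 0)
    ≡⟨ ∑-delta a (f ∘ suc) ⟩
  f (suc a) ∎
  where open ≡-Reasoning

entry≤∑ : ∀ {n} (f : Fin n → ℕ) i → f i ≤ sum f
entry≤∑ f zero    = m≤m+n _ _
entry≤∑ f (suc i) = ≤-trans (entry≤∑ (f ∘ suc) i) (m≤n+m _ _)

two-entries≤∑ : ∀ {n} (f : Fin n → ℕ) {i j} → i ≢ j → f i + f j ≤ sum f
two-entries≤∑ f {zero}  {zero}  i≢j = contradiction refl i≢j
two-entries≤∑ f {zero}  {suc j} _   = +-monoʳ-≤ (f zero) (entry≤∑ (f ∘ suc) j)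
two-entries≤∑ f {suc i} {zero}  _   = ≤-trans (≤-reflexive (+-comm (f (suc i)) (f zero)))
                                              (+-monoʳ-≤ (f zero) (entry≤∑ (f ∘ suc) i))
two-entries≤∑ f {suc i} {suc j} i≢j = ≤-trans (two-entries≤∑ (f ∘ suc) (i≢j ∘ cong suc)) (m≤n+m _ _)

∑≤-with-zero-entry : ∀ {L} (f : Fin (suc L) → ℕ) {c} → (∀ i → f i ≤ c) → ∀ i → f i ≡ 0 → sum f ≤ L * c
∑≤-with-zero-entry {L} f {c} f≤c zero fi≡0 = begin
  f zero + ∑[ i < L ] f (suc i) ≡⟨ cong (_+ ∑[ i < L ] f (suc i)) fi≡0 ⟩
  ∑[ i < L ] f (suc i)          ≤⟨ ∑-mono-≤ (f≤c ∘ suc) ⟩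
  ∑[ i < L ] c                  ≡⟨ ∑-const L c ⟩
  L * c                         ∎
  where open ≤-Reasoning
∑≤-with-zero-entry {suc L} f f≤c (suc i) fi≡0 =
  +-mono-≤ (f≤c zero) (∑≤-with-zero-entry (f ∘ suc) (f≤c ∘ suc) i fi≡0)

∑-++ : ∀ a {b} (f : ℕ → ℕ) → ∑[ i < a + b ] f (toℕ i) ≡ ∑[ i < a ] f (toℕ i) + ∑[ i < b ] f (a + toℕ i)
∑-++ zero    f = refl
∑-++ (suc a) f = trans (cong (f 0 +_) (∑-++ a (f ∘ suc))) (sym (+-assoc (f 0) _ _))

∑-periodic : ∀ m P (f : ℕ → ℕ) → (∀ x → f (P + x) ≡ f x) →
             ∑[ i < m * P ] f (toℕ i) ≡ m * ∑[ i < P ] f (toℕ i)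
∑-periodic zero    P f per = refl
∑-periodic (suc m) P f per = begin
  ∑[ i < P + m * P ] f (toℕ i)                              ≡⟨ ∑-++ P f ⟩
  ∑[ i < P ] f (toℕ i) + ∑[ i < m * P ] f (P + toℕ i)      ≡⟨ cong (∑[ i < P ] f (toℕ i) +_) (sum-cong-≗ {m * P} (per ∘ toℕ)) ⟩
  ∑[ i < P ] f (toℕ i) + ∑[ i < m * P ] f (toℕ i)          ≡⟨ cong (∑[ i < P ] f (toℕ i) +_) (∑-periodic m P f per) ⟩
  ∑[ i < P ] f (toℕ i) + m * ∑[ i < P ] f (toℕ i)          ∎
  where open ≡-Reasoning

∑∑-delta : ∀ {n} (a b : Fin n) (f : Fin n → Fin n → ℕ) →
           ∑[ u < n ] ∑[ w < n ] (if ⌊ a ≟ u ⌋ ∧ ⌊ b ≟ w ⌋ then f u w else 0) ≡ f a b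
∑∑-delta {n} a b f = begin
  ∑[ u < n ] ∑[ w < n ] (if ⌊ a ≟ u ⌋ ∧ ⌊ b ≟ w ⌋ then f u w else 0)
    ≡⟨ sum-cong-≗ {n} (λ u → trans (sum-cong-≗ {n} (λ w → if-∧ ⌊ a ≟ u ⌋ _ _)) (∑-if {n} ⌊ a ≟ u ⌋ _)) ⟩
  ∑[ u < n ] (if ⌊ a ≟ u ⌋ then ∑[ w < n ] (if ⌊ b ≟ w ⌋ then f u w else 0) else 0)
    ≡⟨ ∑-delta a _ ⟩
  ∑[ w < n ] (if ⌊ b ≟ w ⌋ then f a w else 0)
    ≡⟨ ∑-delta b (f a) ⟩
  f a b ∎
  where
  open ≡-Reasoning
  if-∧ : ∀ p q (x : ℕ) → (if p ∧ q then x else 0) ≡ (if p then (if q then x else 0) else 0)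
  if-∧ true  q x = refl
  if-∧ false q x = refl

if-any≤∑ : ∀ {m} {A : Set} (h : A → Bool) (g : Fin m → A) x →
           (if any h (tabulate g) then x else 0) ≤ ∑[ i < m ] (if h (g i) then x else 0)
if-any≤∑ {zero}  h g x = z≤n
if-any≤∑ {suc m} h g x with h (g zero)
... | true  = m≤m+n x _
... | false = if-any≤∑ h (g ∘ suc) x

if-∨≤ : ∀ p q x → (if p ∨ q then x else 0) ≤ (if p then x else 0) + (if q then x else 0)
if-∨≤ true  q x = m≤m+n x _
if-∨≤ false q x = ≤-refl

any-tabulate : ∀ {m} {A : Set} (h : A → Bool) (g : Fin m → A) i → h (g i) ≡ true → any h (tabulate g) ≡ true
any-tabulate h g zero    hgi rewrite hgi = refl
any-tabulate h g (suc i) hgi rewrite any-tabulate h (g ∘ suc) i hgi = ∨-zeroʳ (h (g zero))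

-- Degrees and edge counts

length-filter-tabulate : ∀ {n} {A : Set} (p : A → Bool) (P? : ∀ x → Dec (T (p x))) (g : Fin n → A) →
                         length (filter P? (tabulate g)) ≡ ∑[ i < n ] 𝟙 (p (g i))
length-filter-tabulate {zero}  p P? g = refl
length-filter-tabulate {suc n} p P? g with p (g zero) | P? (g zero)
... | true  | yes _  = cong suc (length-filter-tabulate p P? (g ∘ suc))
... | false | no _   = length-filter-tabulate p P? (g ∘ suc)
... | true  | no ¬t  = contradiction tt ¬t
... | false | yes ()

count≡∑𝟙 : ∀ {n} (p : Fin n → Bool) → count p ≡ ∑[ i < n ] 𝟙 (p i)
count≡∑𝟙 p = length-filter-tabulate p _ id

foldr-+-map-tabulate : ∀ {n} {A : Set} (h : A → ℕ) (g : Fin n → A) →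
                       foldr _+_ 0 (map h (tabulate g)) ≡ ∑[ i < n ] h (g i)
foldr-+-map-tabulate {zero}  h g = refl
foldr-+-map-tabulate {suc n} h g = cong (h (g zero) +_) (foldr-+-map-tabulate h (g ∘ suc))

∣foldr-gcd : ∀ {d xs} → All (d ∣_) xs → d ∣ foldr gcd 0 xs
∣foldr-gcd {d} []            = d ∣0
∣foldr-gcd     (d∣x ∷ d∣xs) = gcd-greatest d∣x (∣foldr-gcd d∣xs)

module _ {n : ℕ} (G : Graph n) where

  deg≡∑ : ∀ u → deg G u ≡ ∑[ v < n ] 𝟙 (adj G u v)
  deg≡∑ u = count≡∑𝟙 (adj G u)

  ∣gcdG : ∀ {d} → (∀ v → d ∣ deg G v) → d ∣ gcdG G
  ∣gcdG d∣deg = ∣foldr-gcd (map⁺ (tabulate⁺ d∣deg))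

  handshake : 2 * numEdges G ≡ ∑[ u < n ] deg G u
  handshake = begin
    2 * E                                       ≡⟨ cong (E +_) (+-identityʳ E) ⟩
    E + E                                       ≡⟨ cong₂ _+_ E≡ (trans E≡ (∑-comm forward)) ⟩
    ∑[ u < n ] ∑[ v < n ] forward u v + ∑[ u < n ] ∑[ v < n ] forward v u
                                                ≡⟨ ∑-distrib-+ (λ u → ∑[ v < n ] forward u v) _ ⟨
    ∑[ u < n ] (∑[ v < n ] forward u v + ∑[ v < n ] forward v u)
                                                ≡⟨ sum-cong-≗ (λ u → ∑-distrib-+ (forward u) _) ⟨
    ∑[ u < n ] ∑[ v < n ] (forward u v + forward v u)
                                                ≡⟨ sum-cong-≗ (λ u → sum-cong-≗ (sym ∘ 𝟙-adj-split u)) ⟩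
    ∑[ u < n ] ∑[ v < n ] 𝟙 (adj G u v)         ≡⟨ sum-cong-≗ (sym ∘ deg≡∑) ⟩
    ∑[ u < n ] deg G u                          ∎
    where
    open ≡-Reasoning
    E = numEdges G
    forward : Fin n → Fin n → ℕ
    forward u v = 𝟙 (adj G u v ∧ ⌊ toℕ u <? toℕ v ⌋)
    E≡ : E ≡ ∑[ u < n ] ∑[ v < n ] forward u v
    E≡ = trans (foldr-+-map-tabulate {n} _ id) (sum-cong-≗ {n} (λ u → count≡∑𝟙 (λ v → adj G u v ∧ ⌊ toℕ u <? toℕ v ⌋)))
    𝟙-adj-split : ∀ u v → 𝟙 (adj G u v) ≡ forward u v + forward v u
    𝟙-adj-split u v with toℕ u <? toℕ v | toℕ v <? toℕ u
    ... | yes u<v | yes v<u = contradiction u<v (<-asym v<u)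
    ... | yes _   | no _    = sym (trans (cong₂ _+_ (cong 𝟙 (∧-identityʳ _)) (cong 𝟙 (∧-zeroʳ _))) (+-identityʳ _))
    ... | no _    | yes _   = trans (cong 𝟙 (Graph.sym G u v)) (sym (cong₂ _+_ (cong 𝟙 (∧-zeroʳ _)) (cong 𝟙 (∧-identityʳ _))))
    ... | no u≮v  | no v≮u  with toℕ-injective (≤-antisym (≮⇒≥ v≮u) (≮⇒≥ u≮v))
    ...   | refl rewrite Graph.irrefl G u = refl

adj-irrefl : ∀ {n} (G : Graph n) {u w} → Adj G u w → u ≢ w
adj-irrefl G {u} uw refl = subst T (Graph.irrefl G u) uw

adj-sym : ∀ {n} (G : Graph n) {u w} → Adj G u w → Adj G w u
adj-sym G {u} {w} = subst T (Graph.sym G u w)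

-- Odd cycles

toℕ-next : ∀ {L} (i : Fin (suc L)) → toℕ i < L → toℕ (next i) ≡ suc (toℕ i)
toℕ-next {L} i i<L with toℕ i <? L
... | yes i<L = toℕ-fromℕ< (s≤s i<L)
... | no i≮L = contradiction i<L i≮L

next-last : ∀ {L} (i : Fin (suc L)) → toℕ i ≡ L → next i ≡ zero
next-last {L} i i≡L with toℕ i <? L
... | yes i<L = contradiction i≡L (<⇒≢ i<L)
... | no _    = refl

walk : ∀ {L} → ℕ → Fin (suc L)
walk zero    = zero
walk (suc m) = next (walk m)

toℕ-walk : ∀ {L} m → m ≤ L → toℕ (walk {L} m) ≡ m
toℕ-walk zero    _   = refl
toℕ-walk (suc m) m<L = trans (toℕ-next (walk m) (subst (_< _) (sym ih) m<L)) (cong suc ih)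
  where ih = toℕ-walk m (<⇒≤ m<L)

odd-cycle-has-constant-step : ∀ t (x : Fin (suc (2 * t)) → Bool) → ∃[ i ] x i ≡ x (next i)
odd-cycle-has-constant-step t x
  with ¬∀⟶∃¬ _ (λ i → x (next i) ≡ not (x i)) (λ i → x (next i) ≟ᵇ not (x i)) alternation-impossible
  where
  alternation-impossible : ¬ (∀ i → x (next i) ≡ not (x i))
  alternation-impossible alt = not-¬ refl (begin
    x zero                     ≡⟨ cong x (next-last (walk (2 * t)) (toℕ-walk (2 * t) ≤-refl)) ⟨
    x (next (walk (2 * t)))    ≡⟨ alt (walk (2 * t)) ⟩
    not (x (walk (2 * t)))     ≡⟨ cong not (even-walk t) ⟩
    not (x zero)               ∎)
    where
    open ≡-Reasoning
    even-walk : ∀ j → x (walk (2 * j)) ≡ x zero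
    even-walk zero    = refl
    even-walk (suc j) = begin
      x (walk (2 * suc j))            ≡⟨ cong (x ∘ walk) (*-suc 2 j) ⟩
      x (next (next (walk (2 * j))))  ≡⟨ alt _ ⟩
      not (x (next (walk (2 * j))))   ≡⟨ cong not (alt _) ⟩
      not (not (x (walk (2 * j))))    ≡⟨ not-involutive _ ⟩
      x (walk (2 * j))                ≡⟨ even-walk j ⟩
      x zero                          ∎
... | i , ¬alt = i , sym (trans (¬-not ¬alt) (not-involutive (x i)))

module _ {n ℓ : ℕ} {G : Graph n} (C : CycleIn ℓ G) where

  cycleSum : (Fin n → Fin n → ℕ) → ℕ
  cycleSum f = ∑[ u < n ] ∑[ w < n ] (if edgeInCycle C u w then f u w else 0)

  private
    c : Fin ℓ → Fin n
    c = vert C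

  cycleSum≤∑steps : ∀ f → cycleSum f ≤ ∑[ i < ℓ ] (f (c i) (c (next i)) + f (c (next i)) (c i))
  cycleSum≤∑steps f = begin
    cycleSum f
      ≤⟨ ∑-mono-≤ (λ u → ∑-mono-≤ (λ w → on-edge≤ u w)) ⟩
    ∑[ u < n ] ∑[ w < n ] ∑[ i < ℓ ] (forward i u w + backward i u w)
      ≡⟨ trans (sum-cong-≗ {n} (λ u → ∑-comm (λ w i → forward i u w + backward i u w))) (∑-comm (λ u i → ∑[ w < n ] (forward i u w + backward i u w))) ⟩
    ∑[ i < ℓ ] ∑[ u < n ] ∑[ w < n ] (forward i u w + backward i u w)
      ≡⟨ sum-cong-≗ {ℓ} (λ i → trans (sum-cong-≗ {n} (λ u → ∑-distrib-+ (λ w → forward i u w) _)) (∑-distrib-+ (λ u → ∑[ w < n ] forward i u w) _)) ⟩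
    ∑[ i < ℓ ] (∑[ u < n ] ∑[ w < n ] forward i u w + ∑[ u < n ] ∑[ w < n ] backward i u w)
      ≡⟨ sum-cong-≗ {ℓ} (λ i → cong₂ _+_ (∑∑-delta (c i) (c (next i)) f) (∑∑-delta (c (next i)) (c i) f)) ⟩
    ∑[ i < ℓ ] (f (c i) (c (next i)) + f (c (next i)) (c i)) ∎
    where
    open ≤-Reasoning
    hits : Fin ℓ → Fin n → Fin n → Bool
    hits i u w = (⌊ c i ≟ u ⌋ ∧ ⌊ c (next i) ≟ w ⌋) ∨ (⌊ c i ≟ w ⌋ ∧ ⌊ c (next i) ≟ u ⌋)
    forward backward : Fin ℓ → Fin n → Fin n → ℕ
    forward  i u w = if ⌊ c i ≟ u ⌋ ∧ ⌊ c (next i) ≟ w ⌋ then f u w else 0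
    backward i u w = if ⌊ c (next i) ≟ u ⌋ ∧ ⌊ c i ≟ w ⌋ then f u w else 0
    on-edge≤ : ∀ u w → (if edgeInCycle C u w then f u w else 0) ≤ ∑[ i < ℓ ] (forward i u w + backward i u w)
    on-edge≤ u w = ≤-trans (if-any≤∑ {ℓ} (λ i → hits i u w) id (f u w)) (∑-mono-≤ (λ i →
      ≤-trans (if-∨≤ (⌊ c i ≟ u ⌋ ∧ ⌊ c (next i) ≟ w ⌋) (⌊ c i ≟ w ⌋ ∧ ⌊ c (next i) ≟ u ⌋) (f u w))
              (≤-reflexive (cong (λ b → forward i u w + (if b then f u w else 0)) (∧-comm ⌊ c i ≟ w ⌋ _)))))

  step≤cycleSum : ∀ f i → f (c i) (c (next i)) + f (c (next i)) (c i) ≤ cycleSum f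
  step≤cycleSum f i = begin
    f a b + f b a                                   ≡⟨ cong₂ _+_ (on-cycle a b ab∈C) (on-cycle b a ba∈C) ⟨
    F a b + F b a                                   ≤⟨ +-mono-≤ (entry≤∑ (F a) b) (entry≤∑ (F b) a) ⟩
    ∑[ w < n ] F a w + ∑[ w < n ] F b w             ≤⟨ two-entries≤∑ (λ u → ∑[ w < n ] F u w) (adj-irrefl G (edges C i)) ⟩
    cycleSum f                                      ∎
    where
    open ≤-Reasoning
    a = c i
    b = c (next i)
    F : Fin n → Fin n → ℕ
    F u w = if edgeInCycle C u w then f u w else 0
    on-cycle : ∀ u w → edgeInCycle C u w ≡ true → F u w ≡ f u w
    on-cycle u w uw∈C rewrite uw∈C = refl
    ab∈C : edgeInCycle C a b ≡ true
    ab∈C = any-tabulate _ id i (cong₂ (λ p q → (p ∧ q) ∨ (⌊ a ≟ b ⌋ ∧ ⌊ b ≟ a ⌋)) (⌊≟⌋-refl a) (⌊≟⌋-refl b))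
    ba∈C : edgeInCycle C b a ≡ true
    ba∈C = any-tabulate _ id i (trans (cong₂ (λ p q → (⌊ a ≟ b ⌋ ∧ ⌊ b ≟ a ⌋) ∨ (p ∧ q)) (⌊≟⌋-refl a) (⌊≟⌋-refl b)) (∨-zeroʳ _))

crossing : ∀ {n} → (Fin n → Bool) → Fin n → Fin n → ℕ
crossing s u w = 𝟙 (s u xor s w)

crossing≤1 : ∀ {n} (s : Fin n → Bool) u w → crossing s u w ≤ 1
crossing≤1 s u w = 𝟙≤1 (s u xor s w)

-- Some edge of the cycle is monochromatic, so at most 2t of its 2t + 1 edges cross, while g is at least 2t on that edge.
cycleSum-crossing≤ : ∀ {n t} {G : Graph n} (s : Fin n → Bool) (g : Fin n → Fin n → ℕ) →
                     (∀ u w → Adj G u w → s u ≡ s w → 2 * t ≤ g u w) →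
                     (C : CycleIn (suc (2 * t)) G) → cycleSum C (crossing s) ≤ cycleSum C g
cycleSum-crossing≤ {t = t} {G} s g mono⇒g C = begin
  cycleSum C (crossing s)               ≤⟨ cycleSum≤∑steps C (crossing s) ⟩
  ∑[ i < suc (2 * t) ] crossings i      ≤⟨ ∑≤-with-zero-entry crossings (λ i → +-mono-≤ (crossing≤1 s _ _) (crossing≤1 s _ _)) i₀ i₀-monochromatic ⟩
  2 * t * 2                             ≡⟨ *-comm (2 * t) 2 ⟩
  2 * t + (2 * t + 0)                   ≡⟨ cong (2 * t +_) (+-identityʳ (2 * t)) ⟩
  2 * t + 2 * t                         ≤⟨ +-mono-≤ (mono⇒g a b ab∈G same) (mono⇒g b a (adj-sym G ab∈G) (sym same)) ⟩
  g a b + g b a                         ≤⟨ step≤cycleSum C g i₀ ⟩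
  cycleSum C g                          ∎
  where
  open ≤-Reasoning
  c = vert C
  crossings : Fin (suc (2 * t)) → ℕ
  crossings i = crossing s (c i) (c (next i)) + crossing s (c (next i)) (c i)
  i₀ = proj₁ (odd-cycle-has-constant-step t (s ∘ c))
  a = c i₀
  b = c (next i₀)
  same : s a ≡ s b
  same = proj₂ (odd-cycle-has-constant-step t (s ∘ c))
  ab∈G : Adj G a b
  ab∈G = edges C i₀
  i₀-monochromatic : crossings i₀ ≡ 0
  i₀-monochromatic rewrite same = cong₂ _+_ (cong 𝟙 (xor-same (s b))) (cong 𝟙 (xor-same (s b)))

-- Fractional decompositions

fromℕ : ℕ → ℚ
fromℕ m = ℤ.+ m / 1

fromℕ≡mkℚ : ∀ m → fromℕ m ≡ mkℚ (ℤ.+ m) 0 (Coprime-sym (1-coprimeTo m))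
fromℕ≡mkℚ m = ℚ.normalize-coprime _

fromℕ-+ : ∀ a b → fromℕ (a + b) ≡ fromℕ a +ℚ fromℕ b
fromℕ-+ a b = begin
  ℤ.+ (a + b) / 1
    ≡⟨ cong (_/ 1) (trans (ℤ.pos-+ a b) (sym (cong₂ ℤ._+_ (ℤ.*-identityʳ (ℤ.+ a)) (ℤ.*-identityʳ (ℤ.+ b))))) ⟩
  ((ℤ.+ a ℤ.* ℤ.1ℤ) ℤ.+ (ℤ.+ b ℤ.* ℤ.1ℤ)) / 1
    ≡⟨ cong₂ _+ℚ_ (fromℕ≡mkℚ a) (fromℕ≡mkℚ b) ⟨
  fromℕ a +ℚ fromℕ b ∎
  where open ≡-Reasoning

fromℕ-mono-≤ : ∀ {a b} → a ≤ b → fromℕ a ≤ℚ fromℕ b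
fromℕ-mono-≤ {a} {b} a≤b = subst₂ _≤ℚ_ (sym (fromℕ≡mkℚ a)) (sym (fromℕ≡mkℚ b))
  (*≤* (subst₂ ℤ._≤_ (sym (ℤ.*-identityʳ (ℤ.+ a))) (sym (ℤ.*-identityʳ (ℤ.+ b))) (ℤ.+≤+ a≤b)))

fromℕ-cancel-≤ : ∀ {a b} → fromℕ a ≤ℚ fromℕ b → a ≤ b
fromℕ-cancel-≤ {a} {b} le with subst₂ _≤ℚ_ (fromℕ≡mkℚ a) (fromℕ≡mkℚ b) le
... | *≤* a≤b = ℤ.drop‿+≤+ (subst₂ ℤ._≤_ (ℤ.*-identityʳ (ℤ.+ a)) (ℤ.*-identityʳ (ℤ.+ b)) a≤b)

fromℕ-∑ : ∀ {n} (f : Fin n → ℕ) → fromℕ (sum f) ≡ ℚΣ.sum (fromℕ ∘ f)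
fromℕ-∑ {zero}  f = refl
fromℕ-∑ {suc n} f = trans (fromℕ-+ (f zero) _) (cong (fromℕ (f zero) +ℚ_) (fromℕ-∑ (f ∘ suc)))

fromℕ-∑∑ : ∀ {n} (f : Fin n → Fin n → ℕ) →
           fromℕ (∑[ u < n ] ∑[ w < n ] f u w) ≡ ℚΣ.∑[ u < n ] ℚΣ.∑[ w < n ] fromℕ (f u w)
fromℕ-∑∑ {n} f = trans (fromℕ-∑ (λ u → ∑[ w < n ] f u w)) (ℚΣ.sum-cong-≗ {n} (fromℕ-∑ ∘ f))

SupportedOnEdges : ∀ {n} → Graph n → (Fin n → Fin n → ℕ) → Set
SupportedOnEdges {n} G f = ∀ u w → adj G u w ≡ false → f u w ≡ 0

module _ {n ℓ : ℕ} {G : Graph n} where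

  weightedSum : List (CycleIn ℓ G × ℚ) → (CycleIn ℓ G → ℕ) → ℚ
  weightedSum []              h = 0ℚ
  weightedSum ((C , α) ∷ ps) h = α *ℚ fromℕ (h C) +ℚ weightedSum ps h

  weightedSum-mono-≤ : ∀ {h h′} ps → All (λ p → 0ℚ <ℚ proj₂ p) ps → (∀ C → h C ≤ h′ C) →
                       weightedSum ps h ≤ℚ weightedSum ps h′
  weightedSum-mono-≤ []              []           h≤h′ = ℚ.≤-refl
  weightedSum-mono-≤ ((C , α) ∷ ps) (0<α ∷ 0<ps) h≤h′ = ℚ.+-mono-≤
    (ℚ.*-monoˡ-≤-nonNeg α {{nonNegative (ℚ.<⇒≤ 0<α)}} (fromℕ-mono-≤ (h≤h′ C)))
    (weightedSum-mono-≤ ps 0<ps h≤h′)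

  ∑∑-*weightOn : ∀ (f : Fin n → Fin n → ℕ) ps →
                 ℚΣ.∑[ u < n ] ℚΣ.∑[ w < n ] (fromℕ (f u w) *ℚ weightOn ps u w) ≡ weightedSum ps (λ C → cycleSum C f)
  ∑∑-*weightOn f [] = trans (ℚΣ.sum-cong-≗ {n} (λ u → trans (ℚΣ.sum-cong-≗ {n} (λ w → ℚ.*-zeroʳ (fromℕ (f u w)))) (ℚΣ.sum-replicate-zero n)))
                            (ℚΣ.sum-replicate-zero n)
  ∑∑-*weightOn f ((C , α) ∷ ps) = begin
    ℚΣ.∑[ u < n ] ℚΣ.∑[ w < n ] (fromℕ (f u w) *ℚ (onC u w +ℚ weightOn ps u w))
      ≡⟨ ℚΣ.sum-cong-≗ {n} (λ u → trans (ℚΣ.sum-cong-≗ {n} (λ w → ℚ.*-distribˡ-+ (fromℕ (f u w)) (onC u w) (weightOn ps u w)))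
                                      (ℚΣ.∑-distrib-+ (λ w → fromℕ (f u w) *ℚ onC u w) (λ w → fromℕ (f u w) *ℚ weightOn ps u w))) ⟩
    ℚΣ.∑[ u < n ] (ℚΣ.∑[ w < n ] (fromℕ (f u w) *ℚ onC u w) +ℚ ℚΣ.∑[ w < n ] (fromℕ (f u w) *ℚ weightOn ps u w))
      ≡⟨ ℚΣ.∑-distrib-+ (λ u → ℚΣ.∑[ w < n ] (fromℕ (f u w) *ℚ onC u w)) _ ⟩
    ℚΣ.∑[ u < n ] ℚΣ.∑[ w < n ] (fromℕ (f u w) *ℚ onC u w) +ℚ ℚΣ.∑[ u < n ] ℚΣ.∑[ w < n ] (fromℕ (f u w) *ℚ weightOn ps u w)
      ≡⟨ cong₂ _+ℚ_ C-part (∑∑-*weightOn f ps) ⟩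
    α *ℚ fromℕ (cycleSum C f) +ℚ weightedSum ps (λ C → cycleSum C f) ∎
    where
    open ≡-Reasoning
    onC : Fin n → Fin n → ℚ
    onC u w = if edgeInCycle C u w then α else 0ℚ
    restrict : ∀ b x → fromℕ x *ℚ (if b then α else 0ℚ) ≡ α *ℚ fromℕ (if b then x else 0)
    restrict true  x = ℚ.*-comm (fromℕ x) α
    restrict false x = trans (ℚ.*-zeroʳ (fromℕ x)) (sym (ℚ.*-zeroʳ α))
    C-part : ℚΣ.∑[ u < n ] ℚΣ.∑[ w < n ] (fromℕ (f u w) *ℚ onC u w) ≡ α *ℚ fromℕ (cycleSum C f)
    C-part = begin
      ℚΣ.∑[ u < n ] ℚΣ.∑[ w < n ] (fromℕ (f u w) *ℚ onC u w)
        ≡⟨ ℚΣ.sum-cong-≗ {n} (λ u → ℚΣ.sum-cong-≗ {n} (λ w → restrict (edgeInCycle C u w) (f u w))) ⟩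
      ℚΣ.∑[ u < n ] ℚΣ.∑[ w < n ] (α *ℚ fromℕ (if edgeInCycle C u w then f u w else 0))
        ≡⟨ ℚΣ.sum-cong-≗ {n} (λ u → ℚΣ.*-distribˡ-sum α (λ w → fromℕ (if edgeInCycle C u w then f u w else 0))) ⟨
      ℚΣ.∑[ u < n ] (α *ℚ ℚΣ.∑[ w < n ] fromℕ (if edgeInCycle C u w then f u w else 0))
        ≡⟨ ℚΣ.*-distribˡ-sum α (λ u → ℚΣ.∑[ w < n ] fromℕ (if edgeInCycle C u w then f u w else 0)) ⟨
      α *ℚ ℚΣ.∑[ u < n ] ℚΣ.∑[ w < n ] fromℕ (if edgeInCycle C u w then f u w else 0)
        ≡⟨ cong (α *ℚ_) (fromℕ-∑∑ (λ u w → if edgeInCycle C u w then f u w else 0)) ⟨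
      α *ℚ fromℕ (cycleSum C f) ∎

  fractional-double-counting : (D : FracDecomp ℓ G) {f : Fin n → Fin n → ℕ} → SupportedOnEdges G f →
    fromℕ (∑[ u < n ] ∑[ w < n ] f u w) ≡ weightedSum (FracDecomp.pieces D) (λ C → cycleSum C f)
  fractional-double-counting D {f} f-on-edges = begin
    fromℕ (∑[ u < n ] ∑[ w < n ] f u w)                        ≡⟨ fromℕ-∑∑ f ⟩
    ℚΣ.∑[ u < n ] ℚΣ.∑[ w < n ] fromℕ (f u w)                  ≡⟨ ℚΣ.sum-cong-≗ {n} (λ u → ℚΣ.sum-cong-≗ {n} (weighted u)) ⟩
    ℚΣ.∑[ u < n ] ℚΣ.∑[ w < n ] (fromℕ (f u w) *ℚ weightOn ps u w) ≡⟨ ∑∑-*weightOn f ps ⟩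
    weightedSum ps (λ C → cycleSum C f)                         ∎
    where
    open ≡-Reasoning
    ps = FracDecomp.pieces D
    weighted : ∀ u w → fromℕ (f u w) ≡ fromℕ (f u w) *ℚ weightOn ps u w
    weighted u w with adj G u w in uw
    ... | true  = sym (trans (cong (fromℕ (f u w) *ℚ_) (FracDecomp.exact D u w (subst T (sym uw) tt))) (ℚ.*-identityʳ _))
    ... | false rewrite f-on-edges u w uw = sym (ℚ.*-zeroˡ (weightOn ps u w))

  cycleSum-dominated⇒dominated : FracDecomp ℓ G → ∀ {f g} → SupportedOnEdges G f → SupportedOnEdges G g →
    (∀ C → cycleSum C f ≤ cycleSum C g) → ∑[ u < n ] ∑[ w < n ] f u w ≤ ∑[ u < n ] ∑[ w < n ] g u w
  cycleSum-dominated⇒dominated D {f} {g} f-on-edges g-on-edges f≤g = fromℕ-cancel-≤ (begin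
    fromℕ (∑[ u < n ] ∑[ w < n ] f u w)    ≡⟨ fractional-double-counting D f-on-edges ⟩
    weightedSum ps (λ C → cycleSum C f)     ≤⟨ weightedSum-mono-≤ ps (FracDecomp.positive D) f≤g ⟩
    weightedSum ps (λ C → cycleSum C g)     ≡⟨ fractional-double-counting D g-on-edges ⟨
    fromℕ (∑[ u < n ] ∑[ w < n ] g u w)    ∎)
    where
    open ℚ.≤-Reasoning
    ps = FracDecomp.pieces D

-- The extremal graph

module BlowUp (t c : ℕ) .{{_ : NonZero t}} where

  k : ℕ
  k = 2 * t

  instance
    k≢0 : NonZero k
    k≢0 = m*n≢0 2 t

  P : ℕ
  P = k + k

  instance
    P≢0 : NonZero P
    P≢0 = >-nonZero (<-≤-trans (>-nonZero⁻¹ k) (m≤m+n k k))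

  n : ℕ
  n = suc c * P

  instance
    n≢0 : NonZero n
    n≢0 = m*n≢0 (suc c) P

  class : ℕ → Fin P
  class x = x mod P

  half : Fin P → Bool
  half i = ⌊ toℕ i <? k ⌋

  colour : Fin n → Bool
  colour u = half (class (toℕ u))

  twins : Fin n → Fin n → Bool
  twins u w = ⌊ class (toℕ u) ≟ class (toℕ w) ⌋ ∧ not ⌊ u ≟ w ⌋

  graph : Graph n
  graph = record
    { adj    = λ u w → (colour u xor colour w) ∨ twins u w
    ; sym    = λ u w → cong₂ _∨_ (xor-comm (colour u) (colour w))
                         (cong₂ _∧_ (⌊≟⌋-sym (class (toℕ u)) _) (cong not (⌊≟⌋-sym u w)))
    ; irrefl = λ u → cong₂ _∨_ (xor-same (colour u))
                         (trans (cong (λ b → ⌊ class (toℕ u) ≟ class (toℕ u) ⌋ ∧ not b) (⌊≟⌋-refl u)) (∧-zeroʳ _))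
    }

  class-periodic : ∀ x → class (P + x) ≡ class x
  class-periodic x = toℕ-injective (begin
    toℕ (class (P + x))  ≡⟨ toℕ-fromℕ< _ ⟩
    (P + x) % P          ≡⟨ cong (_% P) (+-comm P x) ⟩
    (x + P) % P          ≡⟨ [m+n]%n≡m%n x P ⟩
    x % P                ≡⟨ toℕ-fromℕ< _ ⟨
    toℕ (class x)        ∎)
    where open ≡-Reasoning

  class-toℕ : ∀ i → class (toℕ i) ≡ i
  class-toℕ i = toℕ-injective (trans (toℕ-fromℕ< _) (m<n⇒m%n≡m (toℕ<n i)))

  ∑-classes : ∀ (h : Fin P → ℕ) → ∑[ w < n ] h (class (toℕ w)) ≡ suc c * sum h
  ∑-classes h = trans (∑-periodic (suc c) P (h ∘ class) (cong h ∘ class-periodic))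
                      (cong (suc c *_) (sum-cong-≗ {P} (cong h ∘ class-toℕ)))

  ∑-halves : ∀ (h : Bool → ℕ) → ∑[ i < P ] h (half i) ≡ k * h true + k * h false
  ∑-halves h = begin
    ∑[ i < k + k ] h ⌊ toℕ i <? k ⌋                              ≡⟨ ∑-++ k (λ x → h ⌊ x <? k ⌋) ⟩
    ∑[ i < k ] h ⌊ toℕ i <? k ⌋ + ∑[ i < k ] h ⌊ k + toℕ i <? k ⌋
      ≡⟨ cong₂ _+_ (sum-cong-≗ {k} (λ i → cong h (trans (isYes≗does (toℕ i <? k)) (dec-true (toℕ i <? k) (toℕ<n i)))))
                   (sum-cong-≗ {k} (λ i → cong h (trans (isYes≗does (k + toℕ i <? k)) (dec-false (k + toℕ i <? k) (m+n≮m k (toℕ i)))))) ⟩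
    ∑[ i < k ] h true + ∑[ i < k ] h false                      ≡⟨ cong₂ _+_ (∑-const k (h true)) (∑-const k (h false)) ⟩
    k * h true + k * h false                                    ∎
    where open ≡-Reasoning

  crossing-degree : ∀ u → ∑[ w < n ] crossing colour u w ≡ suc c * k
  crossing-degree u = trans (∑-classes (λ i → 𝟙 (colour u xor half i)))
                            (cong (suc c *_) (trans (∑-halves (λ b → 𝟙 (colour u xor b))) (one-half (colour u))))
    where
    one-half : ∀ b → k * 𝟙 (b xor true) + k * 𝟙 (b xor false) ≡ k
    one-half true  = cong₂ _+_ (*-zeroʳ k) (*-identityʳ k)
    one-half false = trans (cong₂ _+_ (*-identityʳ k) (*-zeroʳ k)) (+-identityʳ k)

  twin-degree : ∀ u → ∑[ w < n ] 𝟙 (twins u w) ≡ c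
  twin-degree u = suc-injective (begin
    suc (∑[ w < n ] 𝟙 (twins u w))
      ≡⟨ cong (_+ ∑[ w < n ] 𝟙 (twins u w)) (sym (trans (∑-delta u (𝟙 ∘ same)) (cong 𝟙 (⌊≟⌋-refl (class (toℕ u)))))) ⟩
    ∑[ w < n ] (if ⌊ u ≟ w ⌋ then 𝟙 (same w) else 0) + ∑[ w < n ] 𝟙 (twins u w)
      ≡⟨ ∑-distrib-+ (λ w → if ⌊ u ≟ w ⌋ then 𝟙 (same w) else 0) (λ w → 𝟙 (twins u w)) ⟨
    ∑[ w < n ] ((if ⌊ u ≟ w ⌋ then 𝟙 (same w) else 0) + 𝟙 (twins u w))
      ≡⟨ sum-cong-≗ {n} (λ w → 𝟙-split (same w) ⌊ u ≟ w ⌋) ⟨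
    ∑[ w < n ] 𝟙 (same w)
      ≡⟨ ∑-classes (λ i → 𝟙 ⌊ class (toℕ u) ≟ i ⌋) ⟩
    suc c * ∑[ i < P ] 𝟙 ⌊ class (toℕ u) ≟ i ⌋
      ≡⟨ cong (suc c *_) (∑-delta (class (toℕ u)) (λ _ → 1)) ⟩
    suc c * 1
      ≡⟨ *-identityʳ (suc c) ⟩
    suc c ∎)
    where
    open ≡-Reasoning
    same : Fin n → Bool
    same w = ⌊ class (toℕ u) ≟ class (toℕ w) ⌋

  twins⇒same-colour : ∀ u w → twins u w ≡ true → colour u xor colour w ≡ false
  twins⇒same-colour u w uw-twins with class (toℕ u) ≟ class (toℕ w)
  ... | yes same = trans (cong (λ i → half i xor colour w) same) (xor-same (colour w))
  ... | no _     = contradiction uw-twins λ ()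

  degree : ∀ u → deg graph u ≡ suc c * k + c
  degree u = begin
    deg graph u                                                   ≡⟨ deg≡∑ graph u ⟩
    ∑[ w < n ] 𝟙 ((colour u xor colour w) ∨ twins u w)            ≡⟨ sum-cong-≗ {n} split ⟩
    ∑[ w < n ] (crossing colour u w + 𝟙 (twins u w))              ≡⟨ ∑-distrib-+ (crossing colour u) _ ⟩
    ∑[ w < n ] crossing colour u w + ∑[ w < n ] 𝟙 (twins u w)     ≡⟨ cong₂ _+_ (crossing-degree u) (twin-degree u) ⟩
    suc c * k + c                                                 ∎
    where
    open ≡-Reasoning
    split : ∀ w → 𝟙 ((colour u xor colour w) ∨ twins u w) ≡ crossing colour u w + 𝟙 (twins u w)
    split w = 𝟙-∨-disjoint _ (twins u w) (twins⇒same-colour u w)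

  numEdges-graph : numEdges graph ≡ suc c * k * (suc c * k + c)
  numEdges-graph = *-cancelˡ-≡ _ _ 2 (begin
    2 * numEdges graph                ≡⟨ handshake graph ⟩
    ∑[ u < n ] deg graph u            ≡⟨ sum-cong-≗ {n} degree ⟩
    ∑[ u < n ] (suc c * k + c)        ≡⟨ ∑-const n _ ⟩
    suc c * (k + k) * (suc c * k + c) ≡⟨ double (suc c) k (suc c * k + c) ⟩
    2 * (suc c * k * (suc c * k + c)) ∎)
    where
    open ≡-Reasoning
    double : ∀ a b d → a * (b + b) * d ≡ 2 * (a * b * d)
    double = solve-∀

  crossing-total : ∑[ u < n ] ∑[ w < n ] crossing colour u w ≡ n * (suc c * k)
  crossing-total = trans (sum-cong-≗ {n} crossing-degree) (∑-const n _)

  twins-total : ∑[ u < n ] ∑[ w < n ] (k * 𝟙 (twins u w)) ≡ n * (k * c)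
  twins-total = trans (sum-cong-≗ {n} (λ u → trans (sym (*-distribˡ-sum k (λ w → 𝟙 (twins u w)))) (cong (k *_) (twin-degree u))))
                      (∑-const n _)

  crossing-on-edges : SupportedOnEdges graph (crossing colour)
  crossing-on-edges u w uw∉G with colour u xor colour w
  ... | true  = contradiction uw∉G λ ()
  ... | false = refl

  twins-on-edges : SupportedOnEdges graph (λ u w → k * 𝟙 (twins u w))
  twins-on-edges u w uw∉G with colour u xor colour w | twins u w
  ... | true  | _     = contradiction uw∉G λ ()
  ... | false | true  = contradiction uw∉G λ ()
  ... | false | false = *-zeroʳ k

  monochromatic⇒twins : ∀ u w → Adj graph u w → colour u ≡ colour w → k ≤ k * 𝟙 (twins u w)
  monochromatic⇒twins u w uw∈G same with colour u xor colour w in crosses | twins u w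
  ... | true  | _     = contradiction (trans (sym crosses) (trans (cong (_xor colour w) same) (xor-same (colour w)))) λ ()
  ... | false | true  = ≤-reflexive (sym (*-identityʳ k))
  ... | false | false = ⊥-elim uw∈G

blowUp-dense : ∀ k c p q → p * (2 * (k + k)) < (k + k + 2) * q → 2 * q ≤ suc c →
               p * (suc c * (k + k)) ≤ (suc c * k + c) * q
blowUp-dense k c p q p/q<½+1/2k 2q≤c+1 = *-cancelˡ-≤ 2 (+-cancelʳ-≤ (2 * q) _ _ (begin
  2 * (p * (suc c * (k + k))) + 2 * q    ≤⟨ +-monoʳ-≤ (2 * (p * (suc c * (k + k)))) 2q≤c+1 ⟩
  2 * (p * (suc c * (k + k))) + suc c    ≡⟨ expand₁ c p k ⟩
  suc c * suc (p * (2 * (k + k)))        ≤⟨ *-monoʳ-≤ (suc c) p/q<½+1/2k ⟩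
  suc c * ((k + k + 2) * q)              ≡⟨ expand₂ c k q ⟩
  2 * ((suc c * k + c) * q) + 2 * q      ∎))
  where
  open ≤-Reasoning
  expand₁ : ∀ c p k → 2 * (p * (suc c * (k + k))) + suc c ≡ suc c * suc (p * (2 * (k + k)))
  expand₁ = solve-∀
  expand₂ : ∀ c k q → suc c * ((k + k + 2) * q) ≡ 2 * ((suc c * k + c) * q) + 2 * q
  expand₂ = solve-∀

blowUp-divisible : ∀ ℓ t c .{{_ : NonZero t}} → ℓ ∣ suc c → 2 ∣ c → CycleDivisible ℓ (BlowUp.graph t c)
blowUp-divisible ℓ t c ℓ∣c+1 2∣c =
    subst (ℓ ∣_) (sym numEdges-graph) (∣m⇒∣m*n _ (∣m⇒∣m*n k ℓ∣c+1))
  , ∣gcdG graph (λ u → subst (2 ∣_) (sym (degree u)) (∣m∣n⇒∣m+n (∣n⇒∣m*n (suc c) (m∣m*n t)) 2∣c))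
  where open BlowUp t c

blowUp-¬FracDecomp : ∀ t .{{_ : NonZero t}} c → ¬ FracDecomp (suc (2 * t)) (BlowUp.graph t c)
blowUp-¬FracDecomp t c D = <⇒≱ (>-nonZero⁻¹ k) (+-cancelʳ-≤ (c * k) k 0 (begin
  suc c * k   ≤⟨ *-cancelˡ-≤ n (subst₂ _≤_ crossing-total twins-total dominated) ⟩
  k * c       ≡⟨ *-comm k c ⟩
  c * k       ∎))
  where
  open BlowUp t c
  open ≤-Reasoning
  dominated : ∑[ u < n ] ∑[ w < n ] crossing colour u w ≤ ∑[ u < n ] ∑[ w < n ] (k * 𝟙 (twins u w))
  dominated = cycleSum-dominated⇒dominated D crossing-on-edges twins-on-edges
                (cycleSum-crossing≤ {t = t} colour (λ u w → k * 𝟙 (twins u w)) monochromatic⇒twins)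

-- The threshold

toℚᵘ-fromℕ : ∀ m → toℚᵘ (fromℕ m) ≃ᵘ mkℚᵘ (ℤ.+ m) 0
toℚᵘ-fromℕ m = ℚ.toℚᵘ-fromℚᵘ (mkℚᵘ (ℤ.+ m) 0)

<½+1/⇒ : ∀ {p q-1} .{cop : Coprime p (suc q-1)} d → mkℚ (ℤ.+ p) q-1 cop <ℚ ½ +ℚ ℤ.+ 1 / suc d →
         p * (2 * suc d) < (suc d + 2) * suc q-1
<½+1/⇒ {p} {q-1} d δ< = ℤ.drop‿+<+ (subst₂ ℤ._<_
  (sym (ℤ.pos-* p (2 * suc d)))
  (trans (cong (ℤ._* ℤ.+ suc q-1) (trans (cong₂ ℤ._+_ (ℤ.*-identityˡ (ℤ.+ suc d)) (ℤ.*-identityˡ (ℤ.+ 2))) (sym (ℤ.pos-+ (suc d) 2))))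
         (sym (ℤ.pos-* (suc d + 2) (suc q-1))))
  (ℚᵘ.drop-*<* (ℚᵘ.<-respʳ-≃ ½+1/≃ (ℚ.toℚᵘ-mono-< δ<))))
  where
  ½+1/≃ : toℚᵘ (½ +ℚ ℤ.+ 1 / suc d) ≃ᵘ mkℚᵘ (ℤ.+ 1) 1 +ᵘ mkℚᵘ (ℤ.+ 1) d
  ½+1/≃ = ℚᵘ.≃-trans (ℚ.toℚᵘ-homo-+ ½ (ℤ.+ 1 / suc d)) (ℚᵘ.+-congʳ (mkℚᵘ (ℤ.+ 1) 1) (ℚ.toℚᵘ-fromℚᵘ (mkℚᵘ (ℤ.+ 1) d)))

mkℚ*fromℕ≤fromℕ : ∀ {p q-1} .{cop : Coprime p (suc q-1)} m d → p * m ≤ d * suc q-1 → mkℚ (ℤ.+ p) q-1 cop *ℚ fromℕ m ≤ℚ fromℕ d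
mkℚ*fromℕ≤fromℕ {p} {q-1} {cop} m d pm≤dq = ℚ.toℚᵘ-cancel-≤
  (ℚᵘ.≤-respˡ-≃ (ℚᵘ.≃-sym (ℚᵘ.≃-trans (ℚ.toℚᵘ-homo-* (mkℚ (ℤ.+ p) q-1 cop) (fromℕ m)) (ℚᵘ.*-congˡ {mkℚᵘ (ℤ.+ p) q-1} (toℚᵘ-fromℕ m))))
  (ℚᵘ.≤-respʳ-≃ (ℚᵘ.≃-sym (toℚᵘ-fromℕ d))
  (ℚᵘ.*≤* (subst₂ ℤ._≤_
    (sym (trans (ℤ.*-identityʳ _) (sym (ℤ.pos-* p m))))
    (sym (trans (sym (ℤ.pos-* d _)) (cong (λ z → ℤ.+ (d * suc z)) (*-identityʳ q-1))))
    (ℤ.+≤+ pm≤dq)))))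

odd⇒suc-2* : ∀ ℓ → Odd ℓ → ∃[ t ] ℓ ≡ suc (2 * t)
odd⇒suc-2* zero          ℓ-odd = contradiction (2 ∣0) ℓ-odd
odd⇒suc-2* (suc zero)    _     = 0 , refl
odd⇒suc-2* (suc (suc ℓ)) ℓ-odd with odd⇒suc-2* ℓ (ℓ-odd ∘ ∣m∣n⇒∣m+n ∣-refl)
... | t , refl = suc t , cong suc (sym (*-suc 2 t))

lowerBound-suc : ∀ k → lowerBound (suc k) ≡ ½ +ℚ recip (k + k)
lowerBound-suc k = cong (λ d → ½ +ℚ recip d) (begin
  2 * suc k ∸ 2     ≡⟨ *-distribˡ-∸ 2 (suc k) 1 ⟨
  k + (k + 0)       ≡⟨ cong (k +_) (+-identityʳ k) ⟩
  k + k             ∎)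
  where open ≡-Reasoning

-- c + 1 = (2j + 1)ℓ is an odd multiple of ℓ, and j = N + q makes the blow-up large and dense enough.
-- Matching t as suc _ lets recip (k + k) compute to 1 / (k + k).
threshold-fails : ∀ t .{{_ : NonZero t}} δ → 0ℚ ≤ℚ δ → δ <ℚ lowerBound (suc (2 * t)) → ¬ ThresholdHolds (suc (2 * t)) δ
threshold-fails t (mkℚ ℤ.-[1+ _ ] _ _) (*≤* ())
threshold-fails t@(suc _) δ@(mkℚ (ℤ.+ p) q-1 _) _ δ<lb (N , threshold) =
  blowUp-¬FracDecomp t c (threshold n N≤n graph (blowUp-divisible ℓ t c ℓ∣c+1 (m∣m*n e)) dense)
  where
  ℓ = suc (2 * t)
  q = suc q-1
  j = N + q
  e = t + j * ℓ
  c = 2 * e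
  open BlowUp t c
  open ≤-Reasoning
  factor : ∀ a b → suc (2 * (a + b * suc (2 * a))) ≡ suc (2 * b) * suc (2 * a)
  factor = solve-∀
  ℓ∣c+1 : ℓ ∣ suc c
  ℓ∣c+1 = divides (suc (2 * j)) (factor t j)
  j≤e : j ≤ e
  j≤e = ≤-trans (m≤m*n j ℓ) (m≤n+m (j * ℓ) t)
  N≤n : N ≤ n
  N≤n = begin
    N      ≤⟨ m≤m+n N q ⟩
    j      ≤⟨ j≤e ⟩
    e      ≤⟨ m≤n*m e 2 ⟩
    c      ≤⟨ n≤1+n c ⟩
    suc c  ≤⟨ m≤m*n (suc c) P ⟩
    n      ∎
  2q≤c+1 : 2 * q ≤ suc c
  2q≤c+1 = ≤-trans (*-monoʳ-≤ 2 (≤-trans (m≤n+m q N) j≤e)) (n≤1+n c)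
  dense : ∀ u → δ *ℚ fromℕ n ≤ℚ fromℕ (deg graph u)
  dense u = subst (λ d → δ *ℚ fromℕ n ≤ℚ fromℕ d) (sym (degree u)) (mkℚ*fromℕ≤fromℕ n (suc c * k + c)
              (blowUp-dense k c p q (<½+1/⇒ _ (subst (δ <ℚ_) (lowerBound-suc k) δ<lb)) 2q≤c+1))

corollary2p2 : (ℓ : ℕ) → Odd ℓ → 3 ≤ ℓ →
    (δ : ℚ) → 0ℚ ≤ℚ δ → ThresholdHolds ℓ δ → lowerBound ℓ ≤ℚ δ
corollary2p2 ℓ ℓ-odd 3≤ℓ δ 0≤δ holds with lowerBound ℓ ℚ.≤? δ | odd⇒suc-2* ℓ ℓ-odd
... | yes lb≤δ | _            = lb≤δ
... | no _     | zero , refl  = contradiction 3≤ℓ λ { (s≤s ()) }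
... | no lb≰δ  | suc t , refl = contradiction holds (threshold-fails (suc t) δ 0≤δ (ℚ.≰⇒> lb≰δ))
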